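{- Let $n$ be a positive integer and $p$ a prime with $p^p\mid n$. If $\tau(n)\ge p^2$, then $n$ is not matchable.
   Context: For a positive integer $n$, let $D(n)$ be its set of positive divisors and $\tau(n)=|D(n)|$. A coprime matching between two finite sets of integers of the same cardinality is a bijection $\psi$ between them such that $\gcd(x,\psi(x))=1$ for every $x$ in the domain. A positive integer $n$ is called matchable if there is a coprime matching between $\{1,2,\dots,\tau(n)\}$ and $D(n)$. -}

module Defs where

open import Data.Nat using (ℕ; suc)
open import Data.Nat.Divisibility using (_∣?_)
open import Data.Nat.Coprimality using (Coprime)
open import Data.List using (List; filter; length; lookup; upTo; map)
open import Data.Fin using (Fin; toℕ)
open import Data.Product using (Σ; _×_)
open import Function.Definitions using (Bijective)
open import Relation.Binary.PropositionalEquality using (_≡_)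

divisors : ℕ → List ℕ
divisors n = filter (λ d → d ∣? n) (map suc (upTo n))

τ : ℕ → ℕ
τ n = length (divisors n)

-- n is matchable: a bijection ψ : {1,…,τ(n)} → D(n) with gcd(x, ψ x) = 1.
-- Elements of {1,…,τ(n)} are i+1 for i : Fin (τ n); elements of D(n) are
-- indexed by their position in the duplicate-free list divisors n.
Matchable : ℕ → Set
Matchable n =
  Σ (Fin (τ n) → Fin (τ n)) λ ψ →
    Bijective _≡_ _≡_ ψ ×
    (∀ i → Coprime (suc (toℕ i)) (lookup (divisors n) (ψ i)))

{-# OPTIONS --safe #-}
-- A coprime matching ψ sends the ⌊τ/p⌋ multiples of p in {1, …, τ} to ⌊τ/p⌋ distinct
-- divisors d with p ∤ d. As p^p ∣ n, each such d yields the p + 1 divisors d, dp, …, dp^p,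
-- and all these are distinct since a number determines its p-free part and its p-valuation.
-- So ⌊τ/p⌋ (p + 1) ≤ τ, i.e. ⌊τ/p⌋ ≤ τ mod p < p, which means τ < p².
module Submission where

open import Defs
open import Data.Nat using (ℕ; _^_; _≤_; _<_)
open import Data.Nat.Divisibility using (_∣_)
open import Data.Nat.Primality using (Prime)
open import Relation.Nullary using (¬_)

open import Data.Nat using (zero; suc; _*_; _+_; _∸_; _/_; _%_; NonZero; >-nonZero; nonTrivial⇒≢1)
open import Data.Nat.Properties
open ≤-Reasoning
open import Algebra.Properties.CommutativeSemigroup *-commutativeSemigroup
  using (x∙yz≈y∙xz; xy∙z≈y∙xz)
open import Data.Nat.Divisibility
  using (_∤_; _∣?_; divides; ∣-trans; m∣m*n; n∣m*n; 1∣_; *-monoʳ-∣; *-monoˡ-∣; *-cancelˡ-∣; ∣⇒≤; 0∣⇒≡0)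
open import Data.Nat.DivMod using (m≡m%n+[m/n]*n; m%n<n; m/n*n≤m; m*n/n≡m; /-monoˡ-≤)
open import Data.Nat.Primality using (euclidsLemma; prime⇒nonZero; prime⇒nonTrivial)
open import Data.List using (List; lookup; map; upTo)
open import Data.List.Relation.Unary.All as All using ()
open import Data.List.Relation.Unary.AllPairs using (_∷_)
open import Data.List.Relation.Unary.Any using (index)
open import Data.List.Relation.Unary.Any.Properties using (lookup-index)
open import Data.List.Relation.Unary.Unique.Propositional using (Unique)
import Data.List.Relation.Unary.Unique.Propositional.Properties as Unique
open import Data.List.Membership.Propositional using (_∈_)
open import Data.List.Membership.Propositional.Properties
  using (∈-filter⁺; ∈-filter⁻; ∈-lookup; ∈-map⁺; ∈-upTo⁺)
import Data.Fin as Fin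
open import Data.Fin using (Fin; toℕ; fromℕ<; remQuot)
open import Data.Fin.Properties using (toℕ-injective; toℕ-fromℕ<; toℕ<n; injective⇒≤; *↔×)
open import Data.Product using (_×_; _,_; proj₂)
open import Data.Sum using (inj₁; inj₂)
open import Function using (_∘_)
open import Function.Definitions using (Injective)
open import Function.Bundles using (Injection)
open import Function.Properties.Inverse using (↔⇒↣)
open import Relation.Nullary using (contradiction)
open import Relation.Binary.PropositionalEquality

m^i∣m^j : ∀ m {i j} → i ≤ j → m ^ i ∣ m ^ j
m^i∣m^j m {i} {j} i≤j = divides (m ^ (j ∸ i)) (begin-equality
  m ^ j                 ≡⟨ cong (m ^_) (m+[n∸m]≡n i≤j) ⟨
  m ^ (i + (j ∸ i))     ≡⟨ ^-distribˡ-+-* m i (j ∸ i) ⟩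
  m ^ i * m ^ (j ∸ i)   ≡⟨ *-comm (m ^ i) _ ⟩
  m ^ (j ∸ i) * m ^ i   ∎)

module _ {p : ℕ} (p-prime : Prime p) where
  private instance
    p≢0 : NonZero p
    p≢0 = prime⇒nonZero p-prime

  p^j∣m*d⇒p^j∣m : ∀ {d} → p ∤ d → ∀ j {m} → p ^ j ∣ m * d → p ^ j ∣ m
  p^j∣m*d⇒p^j∣m p∤d zero    {m} _ = 1∣ m
  p^j∣m*d⇒p^j∣m {d} p∤d (suc j) {m} p^[1+j]∣m*d
    with euclidsLemma m d p-prime (∣-trans (m∣m*n (p ^ j)) p^[1+j]∣m*d)
  ... | inj₂ p∣d = contradiction p∣d p∤d
  ... | inj₁ (divides m′ refl) =
    subst (p * p ^ j ∣_) (*-comm p m′) (*-monoʳ-∣ p (p^j∣m*d⇒p^j∣m p∤d j {m′} p^j∣m′*d))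
    where
    p^j∣m′*d : p ^ j ∣ m′ * d
    p^j∣m′*d = *-cancelˡ-∣ p (subst (p * p ^ j ∣_) (xy∙z≈y∙xz m′ p d) p^[1+j]∣m*d)

  d*p^j∣n : ∀ {d n} j → p ∤ d → d ∣ n → p ^ j ∣ n → d * p ^ j ∣ n
  d*p^j∣n {d} j p∤d (divides q refl) p^j∣q*d =
    subst (_∣ q * d) (*-comm (p ^ j) d) (*-monoˡ-∣ d (p^j∣m*d⇒p^j∣m p∤d j {q} p^j∣q*d))

  p∣d*p^[1+j] : ∀ d j → p ∣ d * p ^ suc j
  p∣d*p^[1+j] d j = ∣-trans (m∣m*n {p} (p ^ j)) (n∣m*n d {p * p ^ j})

  d*p^j-injectiveʳ : ∀ {d d′} → p ∤ d → p ∤ d′ → ∀ j j′ → d * p ^ j ≡ d′ * p ^ j′ → j ≡ j′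
  d*p^j-injectiveʳ p∤d p∤d′ zero zero _ = refl
  d*p^j-injectiveʳ {d} {d′} p∤d p∤d′ zero (suc j′) eq =
    contradiction (subst (p ∣_) (trans (sym eq) (*-identityʳ d)) (p∣d*p^[1+j] d′ j′)) p∤d
  d*p^j-injectiveʳ {d} {d′} p∤d p∤d′ (suc j) zero eq =
    contradiction (subst (p ∣_) (trans eq (*-identityʳ d′)) (p∣d*p^[1+j] d j)) p∤d′
  d*p^j-injectiveʳ {d} {d′} p∤d p∤d′ (suc j) (suc j′) eq =
    cong suc (d*p^j-injectiveʳ p∤d p∤d′ j j′ (*-cancelˡ-≡ _ _ p (begin-equality
      p * (d * p ^ j)     ≡⟨ x∙yz≈y∙xz d p (p ^ j) ⟨
      d * (p * p ^ j)     ≡⟨ eq ⟩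
      d′ * (p * p ^ j′)   ≡⟨ x∙yz≈y∙xz d′ p (p ^ j′) ⟩
      p * (d′ * p ^ j′)   ∎)))

  d*p^j-injective : ∀ {d d′ j j′} → p ∤ d → p ∤ d′ → d * p ^ j ≡ d′ * p ^ j′ → d ≡ d′ × j ≡ j′
  d*p^j-injective {d} {d′} {j} {j′} p∤d p∤d′ eq =
    *-cancelʳ-≡ d d′ (p ^ j) {{m^n≢0 p j}} (trans eq (cong (λ i → d′ * p ^ i) (sym j≡j′))) , j≡j′
    where
    j≡j′ : j ≡ j′
    j≡j′ = d*p^j-injectiveʳ p∤d p∤d′ j j′ eq

lookup-injective : ∀ {A : Set} {xs : List A} → Unique xs → Injective _≡_ _≡_ (lookup xs)
lookup-injective (_ ∷ _) {Fin.zero} {Fin.zero} _ = refl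
lookup-injective (x∉xs ∷ _) {Fin.zero} {Fin.suc j} eq = contradiction eq (All.lookup x∉xs (∈-lookup j))
lookup-injective (x∉xs ∷ _) {Fin.suc i} {Fin.zero} eq = contradiction (sym eq) (All.lookup x∉xs (∈-lookup i))
lookup-injective (_ ∷ xs-unique) {Fin.suc i} {Fin.suc j} eq = cong Fin.suc (lookup-injective xs-unique eq)

divisors-unique : ∀ n → Unique (divisors n)
divisors-unique n = Unique.filter⁺ (_∣? n) (Unique.map⁺ suc-injective (Unique.upTo⁺ n))

lookup-divisors-∣ : ∀ n i → lookup (divisors n) i ∣ n
lookup-divisors-∣ n i = proj₂ (∈-filter⁻ (_∣? n) {xs = map suc (upTo n)} (∈-lookup i))

∣⇒∈divisors : ∀ {d n} → 0 < n → d ∣ n → d ∈ divisors n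
∣⇒∈divisors {zero} {suc _} _ 0∣n with () ← 0∣⇒≡0 0∣n
∣⇒∈divisors {suc d} {n} n>0 d∣n =
  ∈-filter⁺ (_∣? n) (∈-map⁺ suc (∈-upTo⁺ (∣⇒≤ {{>-nonZero n>0}} d∣n))) d∣n

module _ {m p : ℕ} .{{_ : NonZero p}} where

  p*[1+a]≤m : (a : Fin (m / p)) → p * suc (toℕ a) ≤ m
  p*[1+a]≤m a = begin
    p * suc (toℕ a)   ≤⟨ *-monoʳ-≤ p (toℕ<n a) ⟩
    p * (m / p)       ≡⟨ *-comm p (m / p) ⟩
    m / p * p         ≤⟨ m/n*n≤m m p ⟩
    m                 ∎

  -- Indices are 0-based on both sides: multiple a is the position of p * (a + 1) in 1, …, m.
  multiple : Fin (m / p) → Fin m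
  multiple a = fromℕ< (subst (_≤ m) (sym (suc-pred (p * suc (toℕ a)) {{m*n≢0 p _}})) (p*[1+a]≤m a))

  1+multiple≡p*[1+a] : ∀ a → suc (toℕ (multiple a)) ≡ p * suc (toℕ a)
  1+multiple≡p*[1+a] a = trans (cong suc (toℕ-fromℕ< _)) (suc-pred (p * suc (toℕ a)) {{m*n≢0 p _}})

  multiple-injective : Injective _≡_ _≡_ multiple
  multiple-injective {a} {a′} eq = toℕ-injective (suc-injective (*-cancelˡ-≡ _ _ p (begin-equality
    p * suc (toℕ a)             ≡⟨ 1+multiple≡p*[1+a] a ⟨
    suc (toℕ (multiple a))      ≡⟨ cong (suc ∘ toℕ) eq ⟩
    suc (toℕ (multiple a′))     ≡⟨ 1+multiple≡p*[1+a] a′ ⟩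
    p * suc (toℕ a′)            ∎)))

module _ {n p : ℕ} (n>0 : 0 < n) (p-prime : Prime p) where
  private instance
    p≢0 : NonZero p
    p≢0 = prime⇒nonZero p-prime

  p∤divisors∧p^e∣n⇒k*[1+e]≤τ : ∀ {e k} → p ^ e ∣ n →
    (f : Fin k → Fin (τ n)) → Injective _≡_ _≡_ f →
    (∀ a → p ∤ lookup (divisors n) (f a)) → k * suc e ≤ τ n
  p∤divisors∧p^e∣n⇒k*[1+e]≤τ {e} {k} p^e∣n f f-injective p∤d =
    injective⇒≤ {f = tower ∘ remQuot (suc e)} (remQuot-injective ∘ tower-injective)
    where
    d : Fin k → ℕ
    d a = lookup (divisors n) (f a)

    tower∈divisors : ∀ a (j : Fin (suc e)) → d a * p ^ toℕ j ∈ divisors n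
    tower∈divisors a j = ∣⇒∈divisors n>0 (d*p^j∣n p-prime (toℕ j) (p∤d a) (lookup-divisors-∣ n (f a))
      (∣-trans (m^i∣m^j p (≤-pred (toℕ<n j))) p^e∣n))

    tower : Fin k × Fin (suc e) → Fin (τ n)
    tower (a , j) = index (tower∈divisors a j)

    tower-injective : Injective _≡_ _≡_ tower
    tower-injective {a , j} {a′ , j′} eq
      with d≡d′ , j≡j′ ← d*p^j-injective p-prime (p∤d a) (p∤d a′) (begin-equality
        d a * p ^ toℕ j                         ≡⟨ lookup-index (tower∈divisors a j) ⟩
        lookup (divisors n) (tower (a , j))     ≡⟨ cong (lookup (divisors n)) eq ⟩
        lookup (divisors n) (tower (a′ , j′))   ≡⟨ lookup-index (tower∈divisors a′ j′) ⟨
        d a′ * p ^ toℕ j′                       ∎)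
      = cong₂ _,_ (f-injective (lookup-injective (divisors-unique n) d≡d′)) (toℕ-injective j≡j′)

    remQuot-injective : Injective _≡_ _≡_ (remQuot {k} (suc e))
    remQuot-injective = Injection.injective (↔⇒↣ (*↔× {k} {suc e}))

  matchable⇒τ/p*[1+e]≤τ : ∀ {e} → p ^ e ∣ n → Matchable n → τ n / p * suc e ≤ τ n
  matchable⇒τ/p*[1+e]≤τ p^e∣n (ψ , (ψ-injective , _) , coprime) =
    p∤divisors∧p^e∣n⇒k*[1+e]≤τ p^e∣n (ψ ∘ multiple) (multiple-injective ∘ ψ-injective) p∤ψ[multiple]
    where
    p∤ψ[multiple] : ∀ a → p ∤ lookup (divisors n) (ψ (multiple a))
    p∤ψ[multiple] a p∣ψ[multiple] =
      nonTrivial⇒≢1 {{prime⇒nonTrivial p-prime}} (coprime (multiple a) (p∣1+multiple , p∣ψ[multiple]))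
      where
      p∣1+multiple : p ∣ suc (toℕ (multiple a))
      p∣1+multiple = subst (p ∣_) (sym (1+multiple≡p*[1+a] a)) (m∣m*n (suc (toℕ a)))

p^2≤m⇒m<m/p*[1+p] : ∀ {m p} .{{_ : NonZero p}} → p ^ 2 ≤ m → m < m / p * suc p
p^2≤m⇒m<m/p*[1+p] {m} {p} p^2≤m = begin-strict
  m                   ≡⟨ m≡m%n+[m/n]*n m p ⟩
  m % p + m / p * p   <⟨ +-monoˡ-< (m / p * p) (m%n<n m p) ⟩
  p + m / p * p       ≤⟨ +-monoˡ-≤ (m / p * p) p≤m/p ⟩
  m / p + m / p * p   ≡⟨ *-suc (m / p) p ⟨
  m / p * suc p       ∎
  where
  p≤m/p : p ≤ m / p
  p≤m/p = begin
    p             ≡⟨ m*n/n≡m p p ⟨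
    p * p / p     ≤⟨ /-monoˡ-≤ p (subst (_≤ m) (cong (p *_) (*-identityʳ p)) p^2≤m) ⟩
    m / p         ∎

corollary2p2 : (n p : ℕ) → 0 < n → Prime p → p ^ p ∣ n →
    p ^ 2 ≤ τ n → ¬ Matchable n
corollary2p2 n p n>0 p-prime p^p∣n p^2≤τ matchable =
  <⇒≱ (p^2≤m⇒m<m/p*[1+p] p^2≤τ) (matchable⇒τ/p*[1+e]≤τ n>0 p-prime p^p∣n matchable)
  where instance _ = prime⇒nonZero p-prime
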